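{- For every formula $\phi$ of the language $\mathcal{RCD}$, if $\phi$ is provable in the axiom system $\mathbf{RCD}$, then $\phi$ is valid.
   Context: Fix a countable set $\textsc{prop}$ of propositional variables and a finite set $\textsc{ag}$ of agents; $\textsc{gr}$ is the set of nonempty subsets of $\textsc{ag}$. The language $\mathcal{RCD}$ is $\phi ::= p \mid \neg\phi \mid \phi\wedge\phi \mid K_i\phi \mid D_G\phi \mid C_G\phi \mid R_G\phi$ ($p\in\textsc{prop}$, $i\in\textsc{ag}$, $G\in\textsc{gr}$); $E_G\phi$ abbreviates $\bigwedge_{i\in G}K_i\phi$. A model is $\mathfrak{M}=(S,\sim,V)$ with each $\sim_i$ an equivalence relation on $S$ and $V:\textsc{prop}\to 2^S$; $\sim_G=\bigcap_{i\in G}\sim_i$. The $G$-resolved update is $\mathfrak{M}|_G=(S,\sim|_G,V)$ with $(\sim|_G)_i=\sim_G$ for $i\in G$ and $(\sim|_G)_i=\sim_i$ for $i\notin G$. Satisfaction: atoms via $V$, Booleans as usual; $K_i\phi$ true at $s$ iff $\phi$ true at all $t$ with $s\sim_it$; $D_G\phi$ iff $\phi$ at all $t$ with $s\sim_Gt$; $C_G\phi$ iff $\phi$ at all $t$ with $(s,t)$ in the reflexive transitive closure of $\bigcup_{i\in G}\sim_i$; $R_G\phi$ true at $s$ in $\mathfrak{M}$ iff $\phi$ true at $s$ in $\mathfrak{M}|_G$. Valid = true at every state of every model. $\mathbf{RCD}$ consists of: (PC) propositional tautologies; (K),(T),(4),(5) for each $K_i$: $K_i(\phi\to\psi)\to(K_i\phi\to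 K_i\psi)$, $K_i\phi\to\phi$, $K_i\phi\to K_iK_i\phi$, $\neg K_i\phi\to K_i\neg K_i\phi$; (MP); (N) from $\phi$ infer $K_i\phi$; (K$_D$) $D_G(\phi\to\psi)\to(D_G\phi\to D_G\psi)$; (T$_D$) $D_G\phi\to\phi$; (5$_D$) $\neg D_G\phi\to D_G\neg D_G\phi$; (D1) $K_i\phi\leftrightarrow D_{\{i\}}\phi$; (D2) $D_G\phi\to D_H\phi$ if $G\subseteq H$; (K$_C$) $C_G(\phi\to\psi)\to(C_G\phi\to C_G\psi)$; (T$_C$) $C_G\phi\to\phi$; (C1) $C_G\phi\to E_GC_G\phi$; (C2) $C_G(\phi\to E_G\phi)\to(\phi\to C_G\phi)$; (N$_C$) from $\phi$ infer $C_G\phi$; (RA) $R_Gp\leftrightarrow p$; (RC) $R_G(\phi\wedge\psi)\leftrightarrow R_G\phi\wedge R_G\psi$; (RN) $R_G\neg\phi\leftrightarrow\neg R_G\phi$; (RD1) $R_GD_H\phi\leftrightarrow D_{G\cup H}R_G\phi$ if $G\cap H\neq\emptyset$; (RD2) $R_GD_H\phi\leftrightarrow D_HR_G\phi$ if $G\cap H=\emptyset$; (N$_R$) from $\phi$ infer $R_G\phi$; (RR$_C$) for any groups $G_1,\dots,G_n,H$: from $\phi\to(E_H\phi\wedge R_{G_1}\cdots R_{G_n}\psi)$ infer $\phi\to R_{G_1}\cdots R_{G_n}C_H\psi$. -}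

module Defs where

open import Level using (0ℓ)
open import Data.Nat using (ℕ)
open import Data.Bool using (Bool; true; false; if_then_else_; not; _∧_)
open import Data.Fin using (Fin)
open import Data.Fin.Subset using (Subset; _∈_; _⊆_; _∪_; _∩_; Nonempty; Empty)
open import Data.Fin.Subset.Properties using (x∈p∪q⁺)
open import Data.Vec using (lookup)
open import Data.List using (List; []; _∷_; foldr; filter)
open import Data.List using (allFin)
open import Data.Product using (Σ; ∃; _×_; _,_; proj₁; proj₂)
open import Data.Sum using (inj₁)
open import Relation.Nullary using (¬_)
open import Relation.Binary.PropositionalEquality using (_≡_)
open import Relation.Binary.Structures using (IsEquivalence)
open import Relation.Binary.Construct.Closure.ReflexiveTransitive using (Star)
open import Relation.Unary using (Decidable)
open import Data.Bool using (T)
open import Relation.Nullary.Decidable using (T?)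

record Grp (n : ℕ) : Set where
  constructor grp
  field
    set      : Subset n
    nonempty : Nonempty set
open Grp public

_∪ᴳ_ : ∀ {n} → Grp n → Grp n → Grp n
G ∪ᴳ H = grp (set G ∪ set H)
             (proj₁ (nonempty G) , x∈p∪q⁺ (inj₁ (proj₂ (nonempty G))))

data Fm (n : ℕ) : Set where
  var  : ℕ → Fm n
  ~_   : Fm n → Fm n
  _&_  : Fm n → Fm n → Fm n
  K    : Fin n → Fm n → Fm n
  D    : Grp n → Fm n → Fm n
  C    : Grp n → Fm n → Fm n
  R    : Grp n → Fm n → Fm n

infixr 6 _&_
infixr 5 _⇒_
infix  4 _⇔_

_⇒_ : ∀ {n} → Fm n → Fm n → Fm n
φ ⇒ ψ = ~ (φ & ~ ψ)

_⇔_ : ∀ {n} → Fm n → Fm n → Fm n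
φ ⇔ ψ = (φ ⇒ ψ) & (ψ ⇒ φ)

⊤ᶠ : ∀ {n} → Fm n
⊤ᶠ = ~ (var 0 & ~ var 0)

-- conjunction of a list of formulas (only ever used on nonempty lists)
⋀ : ∀ {n} → List (Fm n) → Fm n
⋀ []           = ⊤ᶠ
⋀ (φ ∷ [])     = φ
⋀ (φ ∷ ψ ∷ ψs) = φ & ⋀ (ψ ∷ ψs)

members : ∀ {n} → Grp n → List (Fin n)
members {n} G = filter (λ i → T? (lookup (set G) i)) (allFin n)

mapK : ∀ {n} → List (Fin n) → Fm n → List (Fm n)
mapK []       φ = []
mapK (i ∷ is) φ = K i φ ∷ mapK is φ

E : ∀ {n} → Grp n → Fm n → Fm n
E G φ = ⋀ (mapK (members G) φ)

Rs : ∀ {n} → List (Grp n) → Fm n → Fm n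
Rs Gs φ = foldr R φ Gs

data PF : Set where
  pvar : ℕ → PF
  pneg : PF → PF
  pand : PF → PF → PF

evalPF : (ℕ → Bool) → PF → Bool
evalPF v (pvar x)   = v x
evalPF v (pneg a)   = not (evalPF v a)
evalPF v (pand a b) = evalPF v a ∧ evalPF v b

Tautology : PF → Set
Tautology a = ∀ (v : ℕ → Bool) → evalPF v a ≡ true

inst : ∀ {n} → (ℕ → Fm n) → PF → Fm n
inst σ (pvar x)   = σ x
inst σ (pneg a)   = ~ inst σ a
inst σ (pand a b) = inst σ a & inst σ b

data ⊢_ {n : ℕ} : Fm n → Set where
  PC   : ∀ (a : PF) → Tautology a → (σ : ℕ → Fm n) → ⊢ inst σ a
  Kax  : ∀ i φ ψ → ⊢ (K i (φ ⇒ ψ) ⇒ (K i φ ⇒ K i ψ))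
  Tax  : ∀ i φ → ⊢ (K i φ ⇒ φ)
  4ax  : ∀ i φ → ⊢ (K i φ ⇒ K i (K i φ))
  5ax  : ∀ i φ → ⊢ (~ K i φ ⇒ K i (~ K i φ))
  MP   : ∀ {φ ψ} → ⊢ (φ ⇒ ψ) → ⊢ φ → ⊢ ψ
  N    : ∀ i {φ} → ⊢ φ → ⊢ K i φ
  KD   : ∀ G φ ψ → ⊢ (D G (φ ⇒ ψ) ⇒ (D G φ ⇒ D G ψ))
  TD   : ∀ G φ → ⊢ (D G φ ⇒ φ)
  5D   : ∀ G φ → ⊢ (~ D G φ ⇒ D G (~ D G φ))
  D1   : ∀ i φ (ne : Nonempty (Data.Fin.Subset.⁅ i ⁆)) →
           ⊢ (K i φ ⇔ D (grp Data.Fin.Subset.⁅ i ⁆ ne) φ)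
  D2   : ∀ G H φ → set G ⊆ set H → ⊢ (D G φ ⇒ D H φ)
  KC   : ∀ G φ ψ → ⊢ (C G (φ ⇒ ψ) ⇒ (C G φ ⇒ C G ψ))
  TC   : ∀ G φ → ⊢ (C G φ ⇒ φ)
  C1   : ∀ G φ → ⊢ (C G φ ⇒ E G (C G φ))
  C2   : ∀ G φ → ⊢ (C G (φ ⇒ E G φ) ⇒ (φ ⇒ C G φ))
  NC   : ∀ G {φ} → ⊢ φ → ⊢ C G φ
  RA   : ∀ G p → ⊢ (R G (var p) ⇔ var p)
  RC   : ∀ G φ ψ → ⊢ (R G (φ & ψ) ⇔ (R G φ & R G ψ))
  RN   : ∀ G φ → ⊢ (R G (~ φ) ⇔ ~ R G φ)
  RD1  : ∀ G H φ → Nonempty (set G ∩ set H) →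
           ⊢ (R G (D H φ) ⇔ D (G ∪ᴳ H) (R G φ))
  RD2  : ∀ G H φ → Empty (set G ∩ set H) →
           ⊢ (R G (D H φ) ⇔ D H (R G φ))
  NR   : ∀ G {φ} → ⊢ φ → ⊢ R G φ
  RRC  : ∀ (Gs : List (Grp n)) (H : Grp n) {φ ψ} →
           ⊢ (φ ⇒ (E H φ & Rs Gs ψ)) → ⊢ (φ ⇒ Rs Gs (C H ψ))

record Structure (n : ℕ) : Set₁ where
  field
    St  : Set
    Rel : Fin n → St → St → Set
    Val : ℕ → St → Set
open Structure public

IsModel : ∀ {n} → Structure n → Set
IsModel M = ∀ i → IsEquivalence (Rel M i)

RelG : ∀ {n} (M : Structure n) → Grp n → St M → St M → Set
RelG M G s t = ∀ i → i ∈ set G → Rel M i s t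

RelU : ∀ {n} (M : Structure n) → Grp n → St M → St M → Set
RelU M G s t = ∃ λ i → i ∈ set G × Rel M i s t

resolve : ∀ {n} → Grp n → Structure n → Structure n
resolve G M = record
  { St  = St M
  ; Rel = λ i → if lookup (set G) i then RelG M G else Rel M i
  ; Val = Val M }

_,_⊨_ : ∀ {n} (M : Structure n) → St M → Fm n → Set
M , s ⊨ var p   = Val M p s
M , s ⊨ (~ φ)   = ¬ (M , s ⊨ φ)
M , s ⊨ (φ & ψ) = (M , s ⊨ φ) × (M , s ⊨ ψ)
M , s ⊨ K i φ   = ∀ t → Rel M i s t → M , t ⊨ φ
M , s ⊨ D G φ   = ∀ t → RelG M G s t → M , t ⊨ φ
M , s ⊨ C G φ   = ∀ t → Star (RelU M G) s t → M , t ⊨ φ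
M , s ⊨ R G φ   = resolve G M , s ⊨ φ

Valid : ∀ {n} → Fm n → Set₁
Valid {n} φ = ∀ (M : Structure n) → IsModel M → ∀ (s : St M) → M , s ⊨ φ

-- K_i, D_G and C_G are boxes over
-- ~_i, ~_G (both equivalences) and the reflexive–transitive closure of ⋃_{i∈G} ~_i, so their
-- axioms are the familiar frame facts. The reduction axioms for R hold because a resolved
-- model has the same states and valuation: R_G commutes with the Booleans, and ~_H in M|_G
-- is ~_{G∪H} when G meets H and ~_H when it does not. For (RR_C), ~_i in any iterated
-- update refines ~_i in M, so φ propagates along every H-path of the updated model.
-- The propositional part is classical, whence ExcludedMiddle.
module Submission where

open import Defs
open import Level using (0ℓ)
open import Data.Nat using (ℕ)
open import Axiom.ExcludedMiddle using (ExcludedMiddle)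
open import Data.Bool using (Bool; true; false)
open import Data.Bool.Properties using (T-≡)
open import Data.Fin using (Fin)
open import Data.Fin.Subset using (_∈_; _∉_; _∩_; ⁅_⁆; Nonempty; Empty)
open import Data.Fin.Subset.Properties using (x∈p∪q⁺; x∈p∪q⁻; x∈p∩q⁺; x∈p∩q⁻; x∈⁅x⁆; x∈⁅y⁆⇒x≡y)
open import Data.Vec using (lookup)
open import Data.Vec.Properties using (lookup⇒[]=; []=⇒lookup)
open import Data.List using (List; []; _∷_; allFin)
open import Data.List.Relation.Unary.All using (All; []; _∷_)
open import Data.List.Relation.Unary.Any using (here; there)
open import Data.List.Membership.Propositional using () renaming (_∈_ to _∈ˡ_)
open import Data.List.Membership.Propositional.Properties using (∈-filter⁺; ∈-filter⁻; ∈-allFin)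
open import Data.Product using (_×_; _,_; proj₁; proj₂)
open import Data.Sum using (inj₁; inj₂)
open import Function using (_∘_)
open import Function.Bundles using (Equivalence)
open import Relation.Nullary using (¬_; yes; no; does; proof; contradiction)
open import Relation.Nullary.Reflects using (Reflects; invert; ¬-reflects; _×-reflects_)
open import Relation.Nullary.Decidable using (T?)
open import Relation.Binary.Definitions using (Reflexive; Transitive)
open import Relation.Binary.PropositionalEquality using (refl; sym; trans; subst)
open import Relation.Binary.Structures using (IsEquivalence)
open import Relation.Binary.Construct.Closure.ReflexiveTransitive using (Star; ε; _◅_)

⇒-intro : {P Q : Set} → (P → Q) → ¬ (P × ¬ Q)
⇒-intro f (p , ¬q) = ¬q (f p)

⇔-intro : {P Q : Set} → (P → Q) → (Q → P) → ¬ (P × ¬ Q) × ¬ (Q × ¬ P)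
⇔-intro f g = ⇒-intro f , ⇒-intro g

Box : {A : Set} → (A → A → Set) → (A → Set) → A → Set
Box _≈_ P s = ∀ t → s ≈ t → P t

module _ {A : Set} (_≈_ : A → A → Set) where

  Box-zipWith : {P Q S : A → Set} {s : A} →
                (∀ {t} → P t → Q t → S t) → Box _≈_ P s → Box _≈_ Q s → Box _≈_ S s
  Box-zipWith f p q t s≈t = f (p t s≈t) (q t s≈t)

  Box-T : {P : A → Set} {s : A} → Reflexive _≈_ → Box _≈_ P s → P s
  Box-T refl′ p = p _ refl′

  Box-4 : {P : A → Set} {s : A} → Transitive _≈_ → Box _≈_ P s → Box _≈_ (Box _≈_ P) s
  Box-4 trans′ p t s≈t u t≈u = p u (trans′ s≈t t≈u)

  Box-5 : {P : A → Set} {s : A} → IsEquivalence _≈_ →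
          ¬ Box _≈_ P s → Box _≈_ (¬_ ∘ Box _≈_ P) s
  Box-5 eq ¬p t s≈t p = ¬p (λ u s≈u → p u (≈-trans (≈-sym s≈t) s≈u))
    where open IsEquivalence eq using () renaming (sym to ≈-sym; trans to ≈-trans)

  Star-preserves : {P : A → Set} → (∀ {u v} → u ≈ v → P u → P v) →
                   ∀ {s t} → Star _≈_ s t → P s → P t
  Star-preserves step ε        p = p
  Star-preserves step (r ◅ rs) p = Star-preserves step rs (step r p)

module _ {n : ℕ} where

  RelG-isEquivalence : ∀ (M : Structure n) → IsModel M → ∀ G → IsEquivalence (RelG M G)
  RelG-isEquivalence M im G = record
    { refl  = λ i _ → IsEquivalence.refl (im i)
    ; sym   = λ r i i∈G → IsEquivalence.sym (im i) (r i i∈G)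
    ; trans = λ r r′ i i∈G → IsEquivalence.trans (im i) (r i i∈G) (r′ i i∈G)
    }

  resolve-isModel : ∀ (M : Structure n) → IsModel M → ∀ G → IsModel (resolve G M)
  resolve-isModel M im G i with lookup (set G) i
  ... | true  = RelG-isEquivalence M im G
  ... | false = im i

  Rel⇒RelG-⁅⁆ : ∀ (M : Structure n) {i s t} (ne : Nonempty ⁅ i ⁆) →
               Rel M i s t → RelG M (grp ⁅ i ⁆ ne) s t
  Rel⇒RelG-⁅⁆ M {i} {s} {t} _ r j j∈⁅i⁆ = subst (λ k → Rel M k s t) (sym (x∈⁅y⁆⇒x≡y i j∈⁅i⁆)) r

  module _ (M : Structure n) (G : Grp n) {i : Fin n} {s t : St M} where

    resolve-Rel⁺ : (i ∈ set G → RelG M G s t) → (i ∉ set G → Rel M i s t) →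
                   Rel (resolve G M) i s t
    resolve-Rel⁺ in-G out-G with lookup (set G) i in eq
    ... | true  = in-G (lookup⇒[]= i (set G) eq)
    ... | false = out-G (λ i∈G → contradiction (trans (sym ([]=⇒lookup i∈G)) eq) λ ())

    resolve-Rel⇒RelG : i ∈ set G → Rel (resolve G M) i s t → RelG M G s t
    resolve-Rel⇒RelG i∈G r with lookup (set G) i | []=⇒lookup i∈G
    ... | .true | refl = r

    resolve-Rel⇒Rel : Rel (resolve G M) i s t → Rel M i s t
    resolve-Rel⇒Rel r with lookup (set G) i in eq
    ... | true  = r i (lookup⇒[]= i (set G) eq)
    ... | false = r

  module _ (M : Structure n) (G H : Grp n) {s t : St M} where

    RelG-∪ᴳ⇒RelG-resolve : RelG M (G ∪ᴳ H) s t → RelG (resolve G M) H s t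
    RelG-∪ᴳ⇒RelG-resolve r i i∈H =
      resolve-Rel⁺ M G (λ _ j j∈G → r j (x∈p∪q⁺ (inj₁ j∈G))) (λ _ → r i (x∈p∪q⁺ (inj₂ i∈H)))

    -- A shared agent k sees ~_G in M|_G, which gives the G-half of ~_{G∪H}.
    RelG-resolve⇒RelG-∪ᴳ : Nonempty (set G ∩ set H) →
                           RelG (resolve G M) H s t → RelG M (G ∪ᴳ H) s t
    RelG-resolve⇒RelG-∪ᴳ (k , k∈G∩H) r i i∈G∪H with x∈p∪q⁻ (set G) (set H) i∈G∪H
    ... | inj₁ i∈G = resolve-Rel⇒RelG M G k∈G (r k k∈H) i i∈G
      where k∈G = proj₁ (x∈p∩q⁻ (set G) (set H) k∈G∩H)
            k∈H = proj₂ (x∈p∩q⁻ (set G) (set H) k∈G∩H)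
    ... | inj₂ i∈H = resolve-Rel⇒Rel M G (r i i∈H)

    RelG⇒RelG-resolve : Empty (set G ∩ set H) → RelG M H s t → RelG (resolve G M) H s t
    RelG⇒RelG-resolve disjoint r i i∈H =
      resolve-Rel⁺ M G (λ i∈G → contradiction (i , x∈p∩q⁺ (i∈G , i∈H)) disjoint) (λ _ → r i i∈H)

    RelG-resolve⇒RelG : RelG (resolve G M) H s t → RelG M H s t
    RelG-resolve⇒RelG r i i∈H = resolve-Rel⇒Rel M G (r i i∈H)

  ∈members⁺ : ∀ {G : Grp n} {i} → i ∈ set G → i ∈ˡ members G
  ∈members⁺ {G} {i} i∈G =
    ∈-filter⁺ (λ j → T? (lookup (set G) j)) (∈-allFin i) (Equivalence.from T-≡ ([]=⇒lookup i∈G))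

  ∈members⁻ : ∀ {G : Grp n} {i} → i ∈ˡ members G → i ∈ set G
  ∈members⁻ {G} {i} m = lookup⇒[]= i (set G) (Equivalence.to T-≡ T[lookup])
    where T[lookup] = proj₂ (∈-filter⁻ (λ j → T? (lookup (set G) j)) {xs = allFin n} m)

  All-mapK⁺ : ∀ {P : Fm n → Set} {φ} is → (∀ {i} → i ∈ˡ is → P (K i φ)) → All P (mapK is φ)
  All-mapK⁺ []       h = []
  All-mapK⁺ (i ∷ is) h = h (here refl) ∷ All-mapK⁺ is (h ∘ there)

  All-mapK⁻ : ∀ {P : Fm n → Set} {φ} is {i} → All P (mapK is φ) → i ∈ˡ is → P (K i φ)
  All-mapK⁻ (_ ∷ _)  (p ∷ _)  (here refl) = p
  All-mapK⁻ (_ ∷ is) (_ ∷ ps) (there m)   = All-mapK⁻ is ps m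

  module _ (M : Structure n) (s : St M) where

    ⊨⋀⁺ : ∀ {φs} → All (λ φ → M , s ⊨ φ) φs → M , s ⊨ ⋀ φs
    ⊨⋀⁺ []                    = λ (p , ¬p) → ¬p p
    ⊨⋀⁺ (h ∷ [])              = h
    ⊨⋀⁺ {_ ∷ _ ∷ _} (h ∷ hs) = h , ⊨⋀⁺ hs

    ⊨⋀⁻ : ∀ φs → M , s ⊨ ⋀ φs → All (λ φ → M , s ⊨ φ) φs
    ⊨⋀⁻ []           _        = []
    ⊨⋀⁻ (φ ∷ [])     h        = h ∷ []
    ⊨⋀⁻ (φ ∷ ψ ∷ ψs) (h , hs) = h ∷ ⊨⋀⁻ (ψ ∷ ψs) hs

    ⊨E⁺ : ∀ G {φ} → (∀ i → i ∈ set G → M , s ⊨ K i φ) → M , s ⊨ E G φ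
    ⊨E⁺ G h = ⊨⋀⁺ (All-mapK⁺ (members G) (λ m → h _ (∈members⁻ {G} m)))

    ⊨E⁻ : ∀ G {φ} → M , s ⊨ E G φ → ∀ i → i ∈ set G → M , s ⊨ K i φ
    ⊨E⁻ G {φ} h i i∈G = All-mapK⁻ (members G) (⊨⋀⁻ (mapK (members G) φ) h) (∈members⁺ {G} i∈G)

  resolvedRel : List (Grp n) → (M : Structure n) → Fin n → St M → St M → Set
  resolvedRel []       M = Rel M
  resolvedRel (G ∷ Gs) M = resolvedRel Gs (resolve G M)

  -- Not a fold of resolve: the states stay literally St M, so states of M are states of the update.
  resolveAll : List (Grp n) → Structure n → Structure n
  resolveAll Gs M = record { St = St M ; Rel = resolvedRel Gs M ; Val = Val M }

  resolveAll-Rel⇒Rel : ∀ Gs (M : Structure n) {i s t} → Rel (resolveAll Gs M) i s t → Rel M i s t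
  resolveAll-Rel⇒Rel []       M r = r
  resolveAll-Rel⇒Rel (G ∷ Gs) M r = resolve-Rel⇒Rel M G (resolveAll-Rel⇒Rel Gs (resolve G M) r)

  ⊨Rs⁺ : ∀ Gs (M : Structure n) {s φ} → resolveAll Gs M , s ⊨ φ → M , s ⊨ Rs Gs φ
  ⊨Rs⁺ []       M h = h
  ⊨Rs⁺ (G ∷ Gs) M h = ⊨Rs⁺ Gs (resolve G M) h

  ⊨Rs⁻ : ∀ Gs (M : Structure n) {s φ} → M , s ⊨ Rs Gs φ → resolveAll Gs M , s ⊨ φ
  ⊨Rs⁻ []       M h = h
  ⊨Rs⁻ (G ∷ Gs) M h = ⊨Rs⁻ Gs (resolve G M) h

  inst-reflects : ∀ (M : Structure n) s σ v → (∀ x → Reflects (M , s ⊨ σ x) (v x)) →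
                  ∀ a → Reflects (M , s ⊨ inst σ a) (evalPF v a)
  inst-reflects M s σ v ρ = go
    where
      go : ∀ a → Reflects (M , s ⊨ inst σ a) (evalPF v a)
      go (pvar x)   = ρ x
      go (pneg a)   = ¬-reflects (go a)
      go (pand a b) = go a ×-reflects go b

module Classical (lem : ExcludedMiddle 0ℓ) where

  ⇒-elim : {P Q : Set} → ¬ (P × ¬ Q) → P → Q
  ⇒-elim {Q = Q} h p with lem {Q}
  ... | yes q = q
  ... | no ¬q = contradiction (p , ¬q) h

  ⊨inst : ∀ {n} (M : Structure n) s σ a → Tautology a → M , s ⊨ inst σ a
  ⊨inst M s σ a taut =
    invert (subst (Reflects _) (taut v) (inst-reflects M s σ v (λ x → proof (lem {M , s ⊨ σ x})) a))
    where
      v : ℕ → Bool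
      v x = does (lem {M , s ⊨ σ x})

  ⊨C-induction : ∀ {n} (M : Structure n) G {φ s} →
                 M , s ⊨ C G (φ ⇒ E G φ) → M , s ⊨ φ → M , s ⊨ C G φ
  ⊨C-induction M G {φ} h p t st = proj₁ (Star-preserves _ step st (p , h))
    where
      step : ∀ {u v} → RelU M G u v →
             M , u ⊨ φ × M , u ⊨ C G (φ ⇒ E G φ) → M , v ⊨ φ × M , v ⊨ C G (φ ⇒ E G φ)
      step (i , i∈G , r) (p , h) =
        ⊨E⁻ M _ G (⇒-elim (h _ ε) p) i i∈G _ r , λ w st → h w ((i , i∈G , r) ◅ st)

  ⊨RRC : ∀ {n} (M : Structure n) Gs H {φ ψ} →
         (∀ u → M , u ⊨ (φ ⇒ (E H φ & Rs Gs ψ))) → ∀ s → M , s ⊨ (φ ⇒ Rs Gs (C H ψ))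
  ⊨RRC M Gs H {φ} premise s = ⇒-intro λ p → ⊨Rs⁺ Gs M λ t st →
    ⊨Rs⁻ Gs M (proj₂ (⇒-elim (premise t) (Star-preserves _ step st p)))
    where
      step : ∀ {u v} → RelU (resolveAll Gs M) H u v → M , u ⊨ φ → M , v ⊨ φ
      step (i , i∈H , r) p =
        ⊨E⁻ M _ H (proj₁ (⇒-elim (premise _) p)) i i∈H _ (resolveAll-Rel⇒Rel Gs M r)

  sound : ∀ {n} {φ : Fm n} → ⊢ φ → Valid φ
  sound (PC a taut σ)    M im s = ⊨inst M s σ a taut
  sound (Kax i φ ψ)      M im s = ⇒-intro (⇒-intro ∘ Box-zipWith (Rel M i) ⇒-elim)
  sound (Tax i φ)        M im s = ⇒-intro (Box-T (Rel M i) (IsEquivalence.refl (im i)))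
  sound (4ax i φ)        M im s = ⇒-intro (Box-4 (Rel M i) (IsEquivalence.trans (im i)))
  sound (5ax i φ)        M im s = ⇒-intro (Box-5 (Rel M i) (im i))
  sound (MP d e)         M im s = ⇒-elim (sound d M im s) (sound e M im s)
  sound (N i d)          M im s t _ = sound d M im t
  sound (KD G φ ψ)       M im s = ⇒-intro (⇒-intro ∘ Box-zipWith (RelG M G) ⇒-elim)
  sound (TD G φ)         M im s =
    ⇒-intro (Box-T (RelG M G) (IsEquivalence.refl (RelG-isEquivalence M im G)))
  sound (5D G φ)         M im s = ⇒-intro (Box-5 (RelG M G) (RelG-isEquivalence M im G))
  sound (D1 i φ ne)      M im s = ⇔-intro (λ h t r → h t (r i (x∈⁅x⁆ i)))
                                           (λ h t r → h t (Rel⇒RelG-⁅⁆ M ne r))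
  sound (D2 G H φ G⊆H)   M im s = ⇒-intro (λ h t r → h t (λ i i∈G → r i (G⊆H i∈G)))
  sound (KC G φ ψ)       M im s = ⇒-intro (⇒-intro ∘ Box-zipWith (Star (RelU M G)) ⇒-elim)
  sound (TC G φ)         M im s = ⇒-intro (Box-T (Star (RelU M G)) ε)
  sound (C1 G φ)         M im s =
    ⇒-intro (λ h → ⊨E⁺ M s G (λ i i∈G t r u st → h u ((i , i∈G , r) ◅ st)))
  sound (C2 G φ)         M im s = ⇒-intro (⇒-intro ∘ ⊨C-induction M G)
  sound (NC G d)         M im s t _ = sound d M im t
  sound (RA G p)         M im s = ⇔-intro (λ h → h) (λ h → h)
  sound (RC G φ ψ)       M im s = ⇔-intro (λ h → h) (λ h → h)
  sound (RN G φ)         M im s = ⇔-intro (λ h → h) (λ h → h)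
  sound (RD1 G H φ meet) M im s = ⇔-intro (λ h t r → h t (RelG-∪ᴳ⇒RelG-resolve M G H r))
                                           (λ h t r → h t (RelG-resolve⇒RelG-∪ᴳ M G H meet r))
  sound (RD2 G H φ disj) M im s = ⇔-intro (λ h t r → h t (RelG⇒RelG-resolve M G H disj r))
                                           (λ h t r → h t (RelG-resolve⇒RelG M G H r))
  sound (NR G d)         M im s = sound d (resolve G M) (resolve-isModel M im G) s
  sound (RRC Gs H d)     M im s = ⊨RRC M Gs H (sound d M im) s

corollary1 : ExcludedMiddle 0ℓ → (n : ℕ) → (φ : Fm n) → ⊢ φ → Valid φ
corollary1 lem _ _ = Classical.sound lem
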